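{- Let $L_\alpha$, $\alpha<\kappa$, be an inverse system of complete lattices with projections $h^\alpha_\beta:L_\alpha\to L_\beta$, $\beta<\alpha<\kappa$, and let $L_\infty$ be the stratified complete lattice determined by its limit. Then $L_\infty$ is a model iff each $h^\alpha_\beta$ ($\beta<\alpha<\kappa$) is locally completely additive. Moreover, in this case the limit functions $h^\infty_\alpha:L_\infty\to L_\alpha$, $x\mapsto x_\alpha$, are locally completely additive projections.
   Context: Fix a limit ordinal $\kappa$. A stratified complete lattice is $(L,\leq,(\sqsubseteq_\alpha)_{\alpha<\kappa})$ with $(L,\leq)$ a complete lattice and each $\sqsubseteq_\alpha$ a preorder; $x=_\alpha y$ means $x\sqsubseteq_\alpha y$ and $y\sqsubseteq_\alpha x$. A model is one satisfying: (A1) for $\alpha<\beta$, $x\sqsubseteq_\beta y$ implies $x=_\alpha y$; (A2) if $x=_\alpha y$ for all $\alpha$ then $x=y$; (A3) for all $x,\alpha$ there is $y$ with $x=_\alpha y$ such that $x\sqsubseteq_\alpha z$ implies $y\leq z$ (unique, denoted $x|_\alpha$); (A4) for nonempty $I$ and $x_i=_\alpha y$ ($i\in I$), $\bigvee_i x_i=_\alpha y$; (A5) $x\leq y$ implies $x|_\alpha\leq y|_\alpha$; (A6) if $x\leq y$ and $x=_\beta y$ for all $\beta<\alpha$ then $x\sqsubseteq_\alpha y$. For complete lattices $L,L'$, a monotone $h:L'\to L$ is a projection if there is monotone $k:L\to L'$ with $h\circ k=\mathrm{id}_L$ and $k(h(y))\leq y$ for all $y$; $h$ is locally completely additive if for every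 nonempty $Y\subseteq L'$ with $h(Y)=\{x\}$ one has $h(\bigvee Y)=x$. An inverse system: complete lattices $L_\alpha$ and projections $h^\alpha_\beta:L_\alpha\to L_\beta$ ($\beta<\alpha<\kappa$) with $h^\beta_\gamma\circ h^\alpha_\beta=h^\alpha_\gamma$. Its limit $L_\infty$ is the set of $(x_\alpha)_{\alpha<\kappa}\in\prod L_\alpha$ with $h^\alpha_\beta(x_\alpha)=x_\beta$, ordered pointwise (a complete lattice); the stratified complete lattice determined by it has $x\sqsubseteq_\alpha y$ iff $x_\alpha\leq y_\alpha$ and $x_\beta=y_\beta$ for all $\beta<\alpha$. -}

module Defs where

open import Level using (0ℓ)
open import Data.Product using (Σ; ∃; _×_; _,_; proj₁; proj₂)
open import Relation.Binary using (Rel; IsPartialOrder; IsStrictTotalOrder)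
open import Relation.Binary.PropositionalEquality using (_≡_)
open import Induction.WellFounded using (WellFounded)

-- The limit ordinal κ, presented by the well-ordered set of ordinals
-- α < κ: a strict well-order (total, well-founded) that is nonempty and
-- has no greatest element (i.e. κ is a nonzero non-successor ordinal).

record LimitOrdinal : Set₁ where
  field
    Idx                : Set
    _<_                : Rel Idx 0ℓ
    isStrictTotalOrder : IsStrictTotalOrder _≡_ _<_
    wellFounded        : WellFounded _<_
    nonempty           : Idx
    noMax              : ∀ α → ∃ λ β → α < β

  <-trans : ∀ {α β γ} → α < β → β < γ → α < γ
  <-trans = IsStrictTotalOrder.trans isStrictTotalOrder

record OrdSet : Set₁ where
  field
    Carrier : Set
    _≈_     : Rel Carrier 0ℓ
    _≤_     : Rel Carrier 0ℓ

module _ (P : OrdSet) where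
  open OrdSet P

  -- z is a least upper bound of the family f (families indexed by sets
  -- stand for subsets)
  IsLub : {J : Set} → (J → Carrier) → Carrier → Set
  IsLub f z = (∀ j → f j ≤ z) × (∀ u → (∀ j → f j ≤ u) → z ≤ u)

record CompleteLattice : Set₁ where
  field
    ord            : OrdSet
  open OrdSet ord public
  field
    isPartialOrder : IsPartialOrder _≈_ _≤_
    ⋁              : {J : Set} → (J → Carrier) → Carrier
    ⋁-isLub        : {J : Set} (f : J → Carrier) → IsLub ord f (⋁ f)

module _ (P Q : OrdSet) where
  private
    module P = OrdSet P
    module Q = OrdSet Q

  Monotone : (P.Carrier → Q.Carrier) → Set
  Monotone h = ∀ {x y} → x P.≤ y → h x Q.≤ h y

IsProjection : (L' L : OrdSet) → (OrdSet.Carrier L' → OrdSet.Carrier L) → Set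
IsProjection L' L h =
  Monotone L' L h ×
  Σ (OrdSet.Carrier L → OrdSet.Carrier L') λ k →
    Monotone L L' k ×
    (∀ x → OrdSet._≈_ L (h (k x)) x) ×
    (∀ y → OrdSet._≤_ L' (k (h y)) y)

LocallyCompletelyAdditive : (L' L : OrdSet) → (OrdSet.Carrier L' → OrdSet.Carrier L) → Set₁
LocallyCompletelyAdditive L' L h =
  ∀ {J : Set} (Y : J → OrdSet.Carrier L') (x : OrdSet.Carrier L) →
    J →
    (∀ j → OrdSet._≈_ L (h (Y j)) x) →
    ∀ z → IsLub L' Y z → OrdSet._≈_ L (h z) x

module _ (κ : LimitOrdinal) where
  open LimitOrdinal κ

  record Stratified : Set₁ where
    field
      ord    : OrdSet
    open OrdSet ord public
    field
      _⊑[_]_ : Carrier → Idx → Carrier → Set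

    _=[_]_ : Carrier → Idx → Carrier → Set
    x =[ α ] y = (x ⊑[ α ] y) × (y ⊑[ α ] x)

    IsRestriction : Idx → Carrier → Carrier → Set
    IsRestriction α x y = (x =[ α ] y) × (∀ z → x ⊑[ α ] z → y ≤ z)

  record IsModel (S : Stratified) : Set₁ where
    open Stratified S
    field
      A1 : ∀ {α β} → α < β → ∀ {x y} → x ⊑[ β ] y → x =[ α ] y
      A2 : ∀ {x y} → (∀ α → x =[ α ] y) → x ≈ y
      A3 : ∀ x α → ∃ λ y → IsRestriction α x y
      A4 : ∀ α {J : Set} (x : J → Carrier) (y : Carrier) → J →
           (∀ j → x j =[ α ] y) →
           ∀ z → IsLub ord x z → z =[ α ] y
      A5 : ∀ α {x y x' y'} → x ≤ y →
           IsRestriction α x x' → IsRestriction α y y' → x' ≤ y'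
      A6 : ∀ α {x y} → x ≤ y → (∀ β → β < α → x =[ β ] y) → x ⊑[ α ] y

  record InverseSystem : Set₂ where
    field
      L            : Idx → CompleteLattice
    Car : Idx → Set
    Car α = CompleteLattice.Carrier (L α)
    field
      h            : ∀ {α β} → .(β < α) → Car α → Car β
      h-projection : ∀ {α β} .(p : β < α) →
                     IsProjection (CompleteLattice.ord (L α))
                                  (CompleteLattice.ord (L β)) (h p)
      h-compose    : ∀ {α β γ} .(p : γ < β) .(q : β < α) (x : Car α) →
                     CompleteLattice._≈_ (L γ) (h p (h q x)) (h (<-trans p q) x)

    LimCarrier : Set
    LimCarrier = Σ ((α : Idx) → Car α) λ x →
                   ∀ {α β} .(p : β < α) → CompleteLattice._≈_ (L β) (h p (x α)) (x β)

    limOrd : OrdSet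
    limOrd = record
      { Carrier = LimCarrier
      ; _≈_     = λ x y → ∀ α → CompleteLattice._≈_ (L α) (proj₁ x α) (proj₁ y α)
      ; _≤_     = λ x y → ∀ α → CompleteLattice._≤_ (L α) (proj₁ x α) (proj₁ y α)
      }

    L∞ : Stratified
    L∞ = record
      { ord    = limOrd
      ; _⊑[_]_ = λ x α y →
          CompleteLattice._≤_ (L α) (proj₁ x α) (proj₁ y α) ×
          (∀ β → β < α → CompleteLattice._≈_ (L β) (proj₁ x β) (proj₁ y β))
      }

    h∞ : (α : Idx) → LimCarrier → Car α
    h∞ α x = proj₁ x α

module Submission where

-- Write U_γ = h∞ γ U for U in the limit L∞.  The key tool
-- is gluing: x ∈ L_α plus coherent components above α lying over x extends
-- to an element of L∞ (with the projections of x below α).  Two instances: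
--   * ext α x, glued from the sections k(x): the least limit element whose
--     α-component is above x.  It embeds L_α into L∞, preserves joins, and
--     makes every h∞ α a projection.
--   * the fibre top over x, glued from the joins of the fibres {w | h w = x};
--     its coherence is exactly local complete additivity (LCA) of the h^α_β.
-- Since U =_α V in L∞ just means U_α = V_α, the axioms A1-A3, A5, A6 hold in
-- every limit, while A4 at α says that h∞ α is LCA.  Finally, all h∞ α are
-- LCA iff all h^α_β are: ext transports families from L_α into L∞, and the
-- fibre top bounds every family of L∞ lying over a fixed x.

open import Defs
open import Data.Product using (_×_)
open import Function.Bundles using (_⇔_)
open import Data.Product using (Σ; _,_; proj₁; proj₂)
open import Function.Bundles using (mk⇔)
open import Data.Empty using (⊥; ⊥-elim)
open import Data.Empty.Irrelevant using () renaming (⊥-elim to ⊥-elim-irr)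
open import Level using (0ℓ)
open import Relation.Binary using (IsPartialOrder; IsStrictTotalOrder; Poset)
open import Relation.Binary.Definitions using (Tri; tri<; tri≈; tri>)
open import Relation.Binary.PropositionalEquality using (_≡_; refl)
import Relation.Binary.Reasoning.PartialOrder as PosetReasoning

module ProjectionFacts (L' L : CompleteLattice)
    (h : CompleteLattice.Carrier L' → CompleteLattice.Carrier L)
    (π : IsProjection (CompleteLattice.ord L') (CompleteLattice.ord L) h) where
  private
    module L' = CompleteLattice L'
    module L = CompleteLattice L
    module P' = IsPartialOrder L'.isPartialOrder
    module P = IsPartialOrder L.isPartialOrder

  h-mono : ∀ {x y} → x L'.≤ y → h x L.≤ h y
  h-mono = proj₁ π

  k : L.Carrier → L'.Carrier
  k = proj₁ (proj₂ π)

  k-mono : ∀ {x y} → x L.≤ y → k x L'.≤ k y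
  k-mono = proj₁ (proj₂ (proj₂ π))

  h∘k : ∀ x → h (k x) L.≈ x
  h∘k = proj₁ (proj₂ (proj₂ (proj₂ π)))

  k∘h : ∀ y → k (h y) L'.≤ y
  k∘h = proj₂ (proj₂ (proj₂ (proj₂ π)))

  h-cong : ∀ {x y} → x L'.≈ y → h x L.≈ h y
  h-cong e = P.antisym (h-mono (P'.reflexive e)) (h-mono (P'.reflexive (P'.Eq.sym e)))

  k-adjoint : ∀ {x y} → x L.≤ h y → k x L'.≤ y
  k-adjoint {y = y} x≤hy = P'.trans (k-mono x≤hy) (k∘h y)

module Limit (κ : LimitOrdinal) (S : InverseSystem κ) where
  open LimitOrdinal κ
  open InverseSystem S
  open Stratified {κ} L∞ using (_=[_]_; IsRestriction)

  module C (α : Idx) = CompleteLattice (L α)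
  module P (α : Idx) = IsPartialOrder (C.isPartialOrder α)

  poset : Idx → Poset 0ℓ 0ℓ 0ℓ
  poset α = record { isPartialOrder = C.isPartialOrder α }

  module Reasoning (α : Idx) = PosetReasoning (poset α)

  Eq : (α : Idx) → Car α → Car α → Set
  Eq α = C._≈_ α
  syntax Eq α x y = x ≈[ α ] y

  Le : (α : Idx) → Car α → Car α → Set
  Le α = C._≤_ α
  syntax Le α x y = x ≤[ α ] y

  _≤∞_ : LimCarrier → LimCarrier → Set
  _≤∞_ = OrdSet._≤_ limOrd

  irrefl : ∀ {α} → α < α → ⊥
  irrefl = IsStrictTotalOrder.irrefl isStrictTotalOrder refl

  compare : ∀ γ α → Tri (γ < α) (γ ≡ α) (α < γ)
  compare = IsStrictTotalOrder.compare isStrictTotalOrder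

  module Step {α β : Idx} .(p : β < α) = ProjectionFacts (L α) (L β) (h p) (h-projection p)
  open Step using (k)

  -- Sections compose like the projections: k^γ_α = k^γ_δ ∘ k^δ_α for
  -- α < δ < γ, since both are left adjoints of h^γ_α = h^δ_α ∘ h^γ_δ.
  k-compose : ∀ {α δ γ} .(b : α < δ) .(p : δ < γ) (w : Car α) →
              k (<-trans b p) w ≈[ γ ] k p (k b w)
  k-compose {α} {δ} {γ} b p w = P.antisym γ
      (Step.k-adjoint (<-trans b p) (P.reflexive α (P.Eq.sym α w≈hk)))
      (Step.k-adjoint p (Step.k-adjoint b (P.reflexive α (P.Eq.sym α hhk≈w))))
    where
    open Reasoning α
    w≈hk : h (<-trans b p) (k p (k b w)) ≈[ α ] w
    w≈hk = begin-equality
      h (<-trans b p) (k p (k b w)) ≈⟨ P.Eq.sym α (h-compose b p _) ⟩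
      h b (h p (k p (k b w)))       ≈⟨ Step.h-cong b (Step.h∘k p _) ⟩
      h b (k b w)                   ≈⟨ Step.h∘k b w ⟩
      w                             ∎
    hhk≈w : h b (h p (k (<-trans b p) w)) ≈[ α ] w
    hhk≈w = P.Eq.trans α (h-compose b p _) (Step.h∘k (<-trans b p) w)

  -- Components of a limit element below α are determined by its
  -- α-component: x_β = h(x_α).  Hence order and agreement at α propagate down.
  ≤-below : ∀ {α β} (q : β < α) {U V : LimCarrier} →
            h∞ α U ≤[ α ] h∞ α V → h∞ β U ≤[ β ] h∞ β V
  ≤-below {α} {β} q {U} {V} le = begin
    h∞ β U       ≈⟨ proj₂ U q ⟨
    h q (h∞ α U) ≤⟨ Step.h-mono q le ⟩
    h q (h∞ α V) ≈⟨ proj₂ V q ⟩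
    h∞ β V       ∎
    where open Reasoning β

  ≈-below : ∀ {α β} (q : β < α) {U V : LimCarrier} →
            h∞ α U ≈[ α ] h∞ α V → h∞ β U ≈[ β ] h∞ β V
  ≈-below {α} {β} q {U} {V} e = P.antisym β (≤-below q {U} {V} (P.reflexive α e))
                                            (≤-below q {V} {U} (P.reflexive α (P.Eq.sym α e)))

  ≤-from-tail : ∀ α {U V : LimCarrier} → h∞ α U ≤[ α ] h∞ α V →
                (∀ {γ} → α < γ → h∞ γ U ≤[ γ ] h∞ γ V) → U ≤∞ V
  ≤-from-tail α {U} {V} at above γ with compare γ α
  ... | tri< q _ _    = ≤-below q {U} {V} at
  ... | tri≈ _ refl _ = at
  ... | tri> _ _ a    = above a

  agree⇒=[] : ∀ α {U V : LimCarrier} → h∞ α U ≈[ α ] h∞ α V → U =[ α ] V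
  agree⇒=[] α {U} {V} e = (P.reflexive α e , λ β q → ≈-below q {U} {V} e)
                        , (P.reflexive α (P.Eq.sym α e) , λ β q → ≈-below q {V} {U} (P.Eq.sym α e))

  =[]⇒agree : ∀ α {U V : LimCarrier} → U =[ α ] V → h∞ α U ≈[ α ] h∞ α V
  =[]⇒agree α ((U≤V , _) , (V≤U , _)) = P.antisym α U≤V V≤U

  module Glue {α : Idx} (x : Car α) (up : ∀ {γ} → .(α < γ) → Car γ)
      (up-over : ∀ {γ} (a : α < γ) → h a (up a) ≈[ α ] x)
      (up-coherent : ∀ {δ γ} (a : α < γ) (b : α < δ) .(p : δ < γ) →
                     h p (up a) ≈[ δ ] up b) where

    component : ∀ {γ} → Tri (γ < α) (γ ≡ α) (α < γ) → Car γ
    component (tri< q _ _)    = h q x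
    component (tri≈ _ refl _) = x
    component (tri> _ _ a)    = up a

    coherent : ∀ {δ γ} .(p : δ < γ) (t : Tri (γ < α) (γ ≡ α) (α < γ))
               (s : Tri (δ < α) (δ ≡ α) (α < δ)) → h p (component t) ≈[ δ ] component s
    coherent p (tri< a _ _) (tri< b _ _)       = h-compose p a x
    coherent p (tri< a _ _) (tri≈ _ refl _)    = ⊥-elim-irr (irrefl (<-trans p a))
    coherent p (tri< a _ _) (tri> _ _ b)       = ⊥-elim-irr (irrefl (<-trans b (<-trans p a)))
    coherent {δ} p (tri≈ _ refl _) (tri< b _ _) = P.Eq.refl δ
    coherent p (tri≈ _ refl _) (tri≈ _ refl _) = ⊥-elim-irr (irrefl p)
    coherent p (tri≈ _ refl _) (tri> _ _ b)    = ⊥-elim-irr (irrefl (<-trans b p))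
    coherent {δ} p (tri> _ _ a) (tri< b _ _)   = begin-equality
      h p (up a)        ≈⟨ h-compose b a (up a) ⟨
      h b (h a (up a))  ≈⟨ Step.h-cong b (up-over a) ⟩
      h b x             ∎
      where open Reasoning δ
    coherent p (tri> _ _ a) (tri≈ _ refl _)    = up-over a
    coherent p (tri> _ _ a) (tri> _ _ b)       = up-coherent a b p

    glued : LimCarrier
    glued = (λ γ → component (compare γ α)) , λ {γ} {δ} p → coherent p (compare γ α) (compare δ α)

    glued-at : h∞ α glued ≈[ α ] x
    glued-at = at (compare α α)
      where
      at : (t : Tri (α < α) (α ≡ α) (α < α)) → component t ≈[ α ] x
      at (tri< q _ _)    = ⊥-elim (irrefl q)
      at (tri≈ _ refl _) = P.Eq.refl α
      at (tri> _ _ q)    = ⊥-elim (irrefl q)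

    glued-above : ∀ {γ} (a : α < γ) → h∞ γ glued ≈[ γ ] up a
    glued-above {γ} a = above (compare γ α)
      where
      above : (t : Tri (γ < α) (γ ≡ α) (α < γ)) → component t ≈[ γ ] up a
      above (tri< q _ _)    = ⊥-elim (irrefl (<-trans q a))
      above (tri≈ _ refl _) = ⊥-elim (irrefl a)
      above (tri> _ _ _)    = P.Eq.refl γ

  sections-coherent : ∀ {α δ γ} (a : α < γ) (b : α < δ) .(p : δ < γ) (w : Car α) →
                      h p (k a w) ≈[ δ ] k b w
  sections-coherent {δ = δ} a b p w = begin-equality
    h p (k a w)         ≈⟨ Step.h-cong p (k-compose b p w) ⟩
    h p (k p (k b w))   ≈⟨ Step.h∘k p (k b w) ⟩
    k b w               ∎
    where open Reasoning δ

  module Embedding (α : Idx) (w : Car α) =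
    Glue w (λ a → k a w) (λ a → Step.h∘k a w) (λ a b p → sections-coherent a b p w)

  ext : ∀ α → Car α → LimCarrier
  ext α w = Embedding.glued α w

  ext-at : ∀ α (w : Car α) → h∞ α (ext α w) ≈[ α ] w
  ext-at α w = Embedding.glued-at α w

  ext-least : ∀ α {w : Car α} (U : LimCarrier) → w ≤[ α ] h∞ α U → ext α w ≤∞ U
  ext-least α {w} U w≤U = ≤-from-tail α {ext α w} {U}
    (P.trans α (P.reflexive α (ext-at α w)) w≤U)
    (λ {γ} a → P.trans γ (P.reflexive γ (Embedding.glued-above α w a))
                        (Step.k-adjoint a (P.trans α w≤U (P.reflexive α (P.Eq.sym α (proj₂ U a))))))

  ext-mono : ∀ α {w w' : Car α} → w ≤[ α ] w' → ext α w ≤∞ ext α w'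
  ext-mono α {w} {w'} le = ext-least α (ext α w') (P.trans α le (P.reflexive α (P.Eq.sym α (ext-at α w'))))

  -- Being a left adjoint, ext α preserves all joins.
  ext-lub : ∀ α {J : Set} {Y : J → Car α} {z : Car α} → IsLub (C.ord α) Y z →
            IsLub limOrd (λ j → ext α (Y j)) (ext α z)
  ext-lub α (ub , least) =
      (λ j → ext-mono α (ub j))
    , λ U bound → ext-least α U (least (h∞ α U)
        (λ j → P.trans α (P.reflexive α (P.Eq.sym α (ext-at α _))) (bound j α)))

  h∞-projection : ∀ α → IsProjection limOrd (C.ord α) (h∞ α)
  h∞-projection α = (λ le → le α) , ext α , ext-mono α , ext-at α
                  , λ U → ext-least α U (P.refl α)

  LimitMapsLCA : Set₁
  LimitMapsLCA = ∀ α → LocallyCompletelyAdditive limOrd (C.ord α) (h∞ α)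

  StepMapsLCA : Set₁
  StepMapsLCA = ∀ {α β} (p : β < α) → LocallyCompletelyAdditive (C.ord α) (C.ord β) (h p)

  ext-restricts : ∀ α (U : LimCarrier) → IsRestriction α U (ext α (h∞ α U))
  ext-restricts α U = agree⇒=[] α {U} {ext α (h∞ α U)} (P.Eq.sym α (ext-at α (h∞ α U)))
                    , λ V U⊑V → ext-least α V (proj₁ U⊑V)

  -- A5: restriction is monotone, since U' ≤ ext α (U_α) ≤ V' for
  -- restrictions U', V' of U ≤ V.
  restriction-mono : ∀ α {U V U' V' : LimCarrier} → U ≤∞ V →
                     IsRestriction α U U' → IsRestriction α V V' → U' ≤∞ V'
  restriction-mono α {U} {V} {U'} {V'} U≤V (_ , U'-least) (V=V' , _) γ = P.trans γ
    (U'-least (ext α (h∞ α U)) (proj₁ (proj₁ (ext-restricts α U))) γ)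
    (ext-least α V' (P.trans α (U≤V α) (P.reflexive α (=[]⇒agree α {V} {V'} V=V'))) γ)

  -- Axiom A4 at stage α is local complete additivity of h∞ α; all other
  -- axioms hold in every limit.
  model-from-LCA : LimitMapsLCA → IsModel κ L∞
  model-from-LCA lca = record
    { A1 = λ {α} q {U} {V} le → agree⇒=[] α {U} {V} (proj₂ le α q)
    ; A2 = λ {U} {V} agree α → =[]⇒agree α {U} {V} (agree α)
    ; A3 = λ U α → ext α (h∞ α U) , ext-restricts α U
    ; A4 = λ α Y V j₀ Y=V z lub →
             agree⇒=[] α {z} {V} (lca α Y (h∞ α V) j₀ (λ j → =[]⇒agree α {Y j} {V} (Y=V j)) z lub)
    ; A5 = restriction-mono
    ; A6 = λ α {U} {V} U≤V agree → U≤V α , λ β q → =[]⇒agree β {U} {V} (agree β q)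
    }

  -- Conversely A4, applied to a family over x and the element ext α x,
  -- gives local complete additivity of h∞ α.
  LCA-from-model : IsModel κ L∞ → LimitMapsLCA
  LCA-from-model M α Y x j₀ Yx z lub = P.Eq.trans α (=[]⇒agree α {z} {ext α x} z=ext) (ext-at α x)
    where
    z=ext : z =[ α ] ext α x
    z=ext = IsModel.A4 M α Y (ext α x) j₀
              (λ j → agree⇒=[] α {Y j} {ext α x} (P.Eq.trans α (Yx j) (P.Eq.sym α (ext-at α x)))) z lub

  -- Transporting a family of L_α into L∞ along ext α shows that local
  -- complete additivity of the limit maps implies it for the step maps.
  step-LCA-from-limit : LimitMapsLCA → StepMapsLCA
  step-LCA-from-limit lca {α} {β} p Y x j₀ Yx z lub = begin-equality
    h p z                ≈⟨ Step.h-cong p (ext-at α z) ⟨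
    h p (h∞ α (ext α z)) ≈⟨ proj₂ (ext α z) p ⟩
    h∞ β (ext α z)       ≈⟨ lca β (λ j → ext α (Y j)) x j₀ over (ext α z) (ext-lub α lub) ⟩
    x                    ∎
    where
    open Reasoning β
    over : ∀ j → h∞ β (ext α (Y j)) ≈[ β ] x
    over j = P.Eq.trans β (P.Eq.sym β (proj₂ (ext α (Y j)) p))
               (P.Eq.trans β (Step.h-cong p (ext-at α (Y j))) (Yx j))

  -- Under local complete additivity of the step maps, the joins of the
  -- fibres over x ∈ L_α glue to the greatest limit element over x.
  module FiberTop (lca : StepMapsLCA) {α : Idx} (x : Car α) where
    Fiber : ∀ {γ} → .(α < γ) → Set
    Fiber {γ} a = Σ (Car γ) λ w → h a w ≈[ α ] x

    top : ∀ {γ} → .(α < γ) → Car γ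
    top {γ} a = C.⋁ γ {J = Fiber a} proj₁

    top-upper : ∀ {γ} .(a : α < γ) (v : Fiber a) → proj₁ v ≤[ γ ] top a
    top-upper {γ} a = proj₁ (C.⋁-isLub γ proj₁)

    top-least : ∀ {γ} .(a : α < γ) {u : Car γ} → (∀ (v : Fiber a) → proj₁ v ≤[ γ ] u) → top a ≤[ γ ] u
    top-least {γ} a {u} = proj₂ (C.⋁-isLub γ proj₁) u

    -- The fibre over x is nonempty (it contains k x), so LCA applies.
    top-over : ∀ {γ} (a : α < γ) → h a (top a) ≈[ α ] x
    top-over a = lca a proj₁ x (k a x , Step.h∘k a x) proj₂ (top a) (C.⋁-isLub _ proj₁)

    -- h^γ_δ maps the fibre in L_γ onto the fibre in L_δ (onto via k^γ_δ),
    -- so it maps the fibre join to the fibre join.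
    top-coherent : ∀ {δ γ} (a : α < γ) (b : α < δ) .(p : δ < γ) → h p (top a) ≈[ δ ] top b
    top-coherent {δ} {γ} a b p = P.antisym δ
        (top-upper b (h p (top a) , P.Eq.trans α (h-compose b p (top a)) (top-over a)))
        (top-least b λ { (v , v-over) → P.trans δ (P.reflexive δ (P.Eq.sym δ (Step.h∘k p v)))
                                            (Step.h-mono p (top-upper a (k p v , lifted v v-over))) })
      where
      lifted : ∀ v → h b v ≈[ α ] x → h a (k p v) ≈[ α ] x
      lifted v v-over = P.Eq.trans α (P.Eq.sym α (h-compose b p (k p v)))
                          (P.Eq.trans α (Step.h-cong b (Step.h∘k p v)) v-over)

    open Glue x top top-over top-coherent public using (glued; glued-at; glued-above)

    top-greatest : (U : LimCarrier) → h∞ α U ≈[ α ] x → U ≤∞ glued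
    top-greatest U U-over = ≤-from-tail α {U} {glued}
      (P.reflexive α (P.Eq.trans α U-over (P.Eq.sym α glued-at)))
      (λ {γ} a → P.trans γ (top-upper a (h∞ γ U , P.Eq.trans α (proj₂ U a) U-over))
                          (P.reflexive γ (P.Eq.sym γ (glued-above a))))

  -- A family in L∞ over x ∈ L_α is bounded by the fibre top over x, so its
  -- join is still over x.
  limit-LCA-from-step : StepMapsLCA → LimitMapsLCA
  limit-LCA-from-step lca α Y x j₀ Yx z (ub , least) =
    P.antisym α (begin
        h∞ α z      ≤⟨ least glued (λ j → top-greatest (Y j) (Yx j)) α ⟩
        h∞ α glued  ≈⟨ glued-at ⟩
        x           ∎)
      (begin
        x           ≈⟨ Yx j₀ ⟨
        h∞ α (Y j₀) ≤⟨ ub j₀ α ⟩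
        h∞ α z      ∎)
    where
    open FiberTop lca x
    open Reasoning α

  model⇒step-LCA : IsModel κ L∞ → StepMapsLCA
  model⇒step-LCA M = step-LCA-from-limit (LCA-from-model M)

  step-LCA⇒model : StepMapsLCA → IsModel κ L∞
  step-LCA⇒model lca = model-from-LCA (limit-LCA-from-step lca)

open Limit using (model⇒step-LCA; step-LCA⇒model; LCA-from-model; h∞-projection)

proposition1 : (κ : LimitOrdinal) (S : InverseSystem κ) →
    let open LimitOrdinal κ
        open InverseSystem S
    in (IsModel κ L∞ ⇔
          (∀ {α β} (p : β < α) →
             LocallyCompletelyAdditive (CompleteLattice.ord (L α)) (CompleteLattice.ord (L β)) (h p)))
       × (IsModel κ L∞ → ∀ α →
            IsProjection limOrd (CompleteLattice.ord (L α)) (h∞ α)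
            × LocallyCompletelyAdditive limOrd (CompleteLattice.ord (L α)) (h∞ α))
proposition1 κ S =
    mk⇔ (model⇒step-LCA κ S) (step-LCA⇒model κ S)
  , λ M α → h∞-projection κ S α , LCA-from-model κ S M α
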